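{- Let $\mathcal{G}$ be a concurrent game structure, $Z=(\chi,\mathrm{I},\rho)$ a state, and $\phi$ a formula of $\mathcal{L}$. For every information perspective $\mathrm{I}'$ with $\mathrm{I}\!\upharpoonright_{\mathsf{kd}(\phi)+2}=\mathrm{I}'\!\upharpoonright_{\mathsf{kd}(\phi)+2}$ we have $\mathcal{G},(\chi,\mathrm{I},\rho)\Vdash\phi$ if and only if $\mathcal{G},(\chi,\mathrm{I}',\rho)\Vdash\phi$.
   Context: Fix a countable set $\mathsf{Prop}$ of atomic propositions and a finite set $\mathsf{Ag}$ of agents. A concurrent game structure is a tuple $\mathcal{G}=(\mathsf{Ac},\mathsf{V},\mathsf{E},\ell,(\sim_a)_{a\in\mathsf{Ag}})$ where $\mathsf{Ac}$ is a finite set of actions, $\mathsf{V}$ is a finite set of positions, $\mathsf{E}:\mathsf{V}\times\mathsf{Ac}^{\mathsf{Ag}}\to\mathsf{V}$ is a transition function, $\ell:\mathsf{V}\to\mathcal{P}(\mathsf{Prop})$ is a valuation, and for each agent $a$, $\sim_a\subseteq(\mathsf{V}\times\mathsf{V})\cup(\mathsf{Ac}\times\mathsf{Ac})$ is an equivalence relation. A joint action is a function $\alpha:\mathsf{Ag}\to\mathsf{Ac}$; $\alpha\sim_a\beta$ iff $\alpha(b)\sim_a\beta(b)$ for all $b$. A history is a sequence $\rho=v_0\alpha_1v_1\ldots\alpha_nv_n$ of positions and joint actions with $\mathsf{E}(v_i,\alpha_{i+1})=v_{i+1}$ for all $i<n$; $\rho_{\le i}=v_0\alpha_1\ldots\alpha_iv_i$,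 $\mathsf{last}(\rho)=v_n$; $\mathsf{Hist}$ is the set of histories. $\rho\sim_a\rho'$ for histories iff they have the same number $n$ of joint actions, their $i$-th positions are $\sim_a$-related for all $i\le n$ and their $i$-th joint actions are $\sim_a$-related for all $1\le i\le n$. A strategy is a function $\mathsf{Hist}\to\mathsf{Ac}$; an assignment is a function $\chi$ from $\mathsf{Ag}$ to strategies. $\rho$ is consistent with $\chi$ for $X\subseteq\mathsf{Ag}$ if $\alpha_{i+1}(b)=\chi(b)(\rho_{\le i})$ for all $i<n$, $b\in X$. The one-step continuation is $\mathsf{X}^\chi_{\mathcal G}\rho=v_0\alpha_1\ldots\alpha_nv_n\alpha_{n+1}v_{n+1}$ with $\alpha_{n+1}(b)=\chi(b)(\rho)$ for all $b$ and $v_{n+1}=\mathsf{E}(v_n,\alpha_{n+1})$. $\mathsf{Ag}^*$ is the set of finite words over $\mathsf{Ag}$ with no two equal adjacent letters; $\mathsf{len}(w)$ is the length of $w$; $\mathsf{Ag}^{\ge n}$ is the set of words in $\mathsf{Ag}^*$ of length $\ge n$; $aw$ denotes $w$ prefixed by $a$. For $X\subseteq\mathsf{Ag}^*$ and $n\in\mathbb{N}$, $X\!\upharpoonright_n=\{w\in X:\mathsf{len}(w)\le n\}$. An information perspective is a set $\mathrm{I}\subseteq\mathsf{Ag}^{\ge2}$; $\mathrm{I}_a=\{b: ab\in\mathrm{I}\}\cup\{a\}$; $\mathrm{I}[a]=\{w\in\mathsf{Ag}^{\ge2}: aw\in\mathrm{I}\}\cup\{w\in\mathrm{I}: w=aw'\text{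 for some }w'\in\mathsf{Ag}^*\}$. $\chi\sim^{\mathrm{I}}_a\chi'$ iff $\chi(b)=\chi'(b)$ for all $b\in\mathrm{I}_a$. A state is a triple $(\chi,\mathrm{I},\rho)$ (assignment, information perspective, history); it is $a$-consistent if $\rho$ is consistent with $\chi$ for $\mathrm{I}_a$. $(\chi,\mathrm{I},\rho)\trianglelefteq_a(\chi',\mathrm{I}',\rho')$ iff $\chi\sim^{\mathrm{I}}_a\chi'$, $\mathrm{I}[a]\subseteq\mathrm{I}'$, $\rho\sim_a\rho'$, and both states are $a$-consistent. Formulas of $\mathcal{L}$: $\phi::=p\mid\bot\mid\phi\to\phi\mid\mathsf{K}_a\phi\mid\mathsf{X}\phi$ with $p\in\mathsf{Prop}$, $a\in\mathsf{Ag}$. Truth at $Z=(\chi,\mathrm{I},\rho)$: $\mathcal{G},Z\Vdash p$ iff $p\in\ell(\mathsf{last}(\rho))$; $\bot$ is never true; $\to$ is classical; $\mathcal{G},Z\Vdash\mathsf{K}_a\phi$ iff $\mathcal{G},Z'\Vdash\phi$ for all states $Z'$ with $Z\trianglelefteq_aZ'$; $\mathcal{G},Z\Vdash\mathsf{X}\phi$ iff $\mathcal{G},(\chi,\mathrm{I},\mathsf{X}^\chi_{\mathcal G}\rho)\Vdash\phi$. The $\mathsf{K}$-depth is defined by $\mathsf{kd}(p)=\mathsf{kd}(\bot)=0$, $\mathsf{kd}(\phi\to\psi)=\max(\mathsf{kd}(\phi),\mathsf{kd}(\psi))$, $\mathsf{kd}(\mathsf{K}_a\phi)=\mathsf{kd}(\phi)+1$,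 $\mathsf{kd}(\mathsf{X}\phi)=\mathsf{kd}(\phi)$. -}

module Defs where

open import Level using (Level; 0ℓ; Lift) renaming (suc to lsuc)
open import Data.Nat using (ℕ; zero; suc; _+_; _≤_; _⊔_)
open import Data.Fin using (Fin)
open import Data.List using (List; []; _∷_; length)
open import Data.List.Relation.Unary.Linked using (Linked)
open import Data.Product using (Σ; ∃; _×_; _,_)
open import Data.Sum using (_⊎_)
open import Data.Empty using (⊥)
open import Data.Unit using (⊤)
open import Relation.Nullary using (¬_)
open import Relation.Unary using (Pred)
open import Relation.Binary using (Rel; IsEquivalence)
open import Relation.Binary.PropositionalEquality using (_≡_; _≢_)
open import Function.Bundles using (_⇔_)

Prop : Set
Prop = ℕ

-- The relation ∼_a ⊆ (V×V) ∪ (Ac×Ac) is split into its two components,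
-- each an equivalence relation.
record CGS (nAg : ℕ) : Set₁ where
  field
    nAc : ℕ
    nV  : ℕ
    E   : Fin nV → (Fin nAg → Fin nAc) → Fin nV
    ℓ   : Fin nV → Pred Prop 0ℓ
    simV : Fin nAg → Rel (Fin nV) 0ℓ
    simA : Fin nAg → Rel (Fin nAc) 0ℓ
    simV-equiv : ∀ a → IsEquivalence (simV a)
    simA-equiv : ∀ a → IsEquivalence (simA a)

Word : ℕ → Set
Word nAg = List (Fin nAg)

InAg* : ∀ {nAg} → Word nAg → Set
InAg* w = Linked _≢_ w

InAg≥2 : ∀ {nAg} → Word nAg → Set
InAg≥2 w = InAg* w × (2 ≤ length w)

record InfoPersp (nAg : ℕ) : Set₁ where
  field
    mem : Pred (Word nAg) 0ℓ
    wf  : ∀ w → mem w → InAg≥2 w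
open InfoPersp public

Isub : ∀ {nAg} → InfoPersp nAg → Fin nAg → Pred (Fin nAg) 0ℓ
Isub I a b = mem I (a ∷ b ∷ []) ⊎ b ≡ a

Ishift : ∀ {nAg} → InfoPersp nAg → Fin nAg → Pred (Word nAg) 0ℓ
Ishift I a w = (InAg≥2 w × mem I (a ∷ w)) ⊎ (mem I w × ∃ λ w' → w ≡ a ∷ w')

_≡↾_at_ : ∀ {nAg} → InfoPersp nAg → InfoPersp nAg → ℕ → Set
I ≡↾ I' at n = ∀ w → length w ≤ n → (mem I w ⇔ mem I' w)

data Form (nAg : ℕ) : Set where
  atom : Prop → Form nAg
  ⊥f   : Form nAg
  _⇒_  : Form nAg → Form nAg → Form nAg
  K    : Fin nAg → Form nAg → Form nAg
  X    : Form nAg → Form nAg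

kd : ∀ {nAg} → Form nAg → ℕ
kd (atom p) = 0
kd ⊥f = 0
kd (φ ⇒ ψ) = kd φ ⊔ kd ψ
kd (K a φ) = suc (kd φ)
kd (X φ) = kd φ

module _ {nAg : ℕ} (G : CGS nAg) where
  open CGS G

  JAct : Set
  JAct = Fin nAg → Fin nAc

  -- A history v0 α1 v1 … αn vn; since E is a function, the positions
  -- v_{i+1} = E(v_i, α_{i+1}) are determined by v0 and the actions.
  data Hist : Set where
    start : Fin nV → Hist
    _▷_   : Hist → JAct → Hist

  last : Hist → Fin nV
  last (start v) = v
  last (ρ ▷ α) = E (last ρ) α

  Strategy : Set
  Strategy = Hist → Fin nAc

  Assignment : Set
  Assignment = Fin nAg → Strategy

  JActSim : Fin nAg → JAct → JAct → Set
  JActSim a α β = ∀ b → simA a (α b) (β b)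

  HistSim : Fin nAg → Hist → Hist → Set
  HistSim a (start v) (start v') = simV a v v'
  HistSim a (start v) (ρ' ▷ α') = ⊥
  HistSim a (ρ ▷ α) (start v') = ⊥
  HistSim a (ρ ▷ α) (ρ' ▷ α') =
    HistSim a ρ ρ' × JActSim a α α' × simV a (E (last ρ) α) (E (last ρ') α')

  Consistent : Assignment → Pred (Fin nAg) 0ℓ → Hist → Set
  Consistent χ P (start v) = ⊤
  Consistent χ P (ρ ▷ α) = Consistent χ P ρ × (∀ b → P b → α b ≡ χ b ρ)

  next : Assignment → Hist → Hist
  next χ ρ = ρ ▷ (λ b → χ b ρ)

  record State : Set₁ where
    constructor ⟨_,_,_⟩
    field
      asg  : Assignment
      persp : InfoPersp nAg
      hist : Hist

  AsgSim : InfoPersp nAg → Fin nAg → Assignment → Assignment → Set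
  AsgSim I a χ χ' = ∀ b → (Isub I a) b → ∀ h → χ b h ≡ χ' b h

  aConsistent : Fin nAg → State → Set
  aConsistent a ⟨ χ , I , ρ ⟩ = Consistent χ (Isub I a) ρ

  ⊴ : Fin nAg → State → State → Set
  ⊴ a Z@(⟨ χ , I , ρ ⟩) Z'@(⟨ χ' , I' , ρ' ⟩) =
    AsgSim I a χ χ'
    × (∀ w → Ishift I a w → mem I' w)
    × HistSim a ρ ρ'
    × aConsistent a Z × aConsistent a Z'

  Sat : State → Form nAg → Set₁
  Sat Z (atom p) = Lift (lsuc 0ℓ) (ℓ (last (State.hist Z)) p)
  Sat Z ⊥f = Lift (lsuc 0ℓ) ⊥
  Sat Z (φ ⇒ ψ) = Sat Z φ → Sat Z ψ
  Sat Z (K a φ) = ∀ Z' → ⊴ a Z Z' → Sat Z' φ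
  Sat ⟨ χ , I , ρ ⟩ (X φ) = Sat ⟨ χ , I , next χ ρ ⟩ φ

{-# OPTIONS --safe #-}
-- By induction on φ, strengthening the equivalence to all assignments and
-- histories.  The only interesting case is K a φ: a ⊴ₐ-successor (χ″, J, ρ″)
-- of the state with perspective I' becomes a ⊴ₐ-successor of the state with
-- perspective I once I[a] is added to J.  This enlargement is invisible to
-- words of length ≤ kd φ + 2, because on such words I[a] only inspects I up
-- to length kd φ + 3, where I and I' agree and I'[a] ⊆ J already.
module Submission where

open import Defs
open import Data.Nat using (ℕ; _+_; _≤_; suc; s≤s; z≤n)
open import Data.Nat.Properties using (≤-trans; m≤n+m; m≤m⊔n; m≤n⊔m; +-monoˡ-≤; n≤1+n)
open import Data.Sum using (_⊎_; inj₁; inj₂; [_,_])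
open import Data.Product using (_,_)
open import Data.List using (_∷_; []; length)
open import Data.Unit using (tt)
open import Data.Fin using (Fin)
open import Function using (_∘_)
open import Function.Bundles using (_⇔_; mk⇔; Equivalence)
open import Relation.Unary using (Pred; _⊆_)
open import Level using (0ℓ)

open Equivalence

module _ {nAg : ℕ} where

  ≡↾-sym : ∀ (I I' : InfoPersp nAg) {n} → I ≡↾ I' at n → I' ≡↾ I at n
  ≡↾-sym _ _ I≡I' w l = mk⇔ (from (I≡I' w l)) (to (I≡I' w l))

  ≡↾-restrict : ∀ (I I' : InfoPersp nAg) {m n} → m ≤ n → I ≡↾ I' at n → I ≡↾ I' at m
  ≡↾-restrict _ _ m≤n I≡I' w l = I≡I' w (≤-trans l m≤n)

  _∪ᴾ_ : InfoPersp nAg → InfoPersp nAg → InfoPersp nAg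
  I ∪ᴾ J = record { mem = λ w → mem I w ⊎ mem J w ; wf = λ w → [ wf I w , wf J w ] }

  shiftPersp : InfoPersp nAg → Fin nAg → InfoPersp nAg
  shiftPersp I a = record
    { mem = Ishift I a
    ; wf  = λ { w (inj₁ (w∈Ag≥2 , _)) → w∈Ag≥2 ; w (inj₂ (w∈I , _)) → wf I w w∈I }
    }

  ∪ᴾ-≡↾ˡ : ∀ (I J : InfoPersp nAg) {n}
         → (∀ w → length w ≤ n → mem J w → mem I w) → (I ∪ᴾ J) ≡↾ I at n
  ∪ᴾ-≡↾ˡ _ _ J⊆I w l = mk⇔ [ (λ w∈I → w∈I) , J⊆I w l ] inj₁

  Isub-⊆ : ∀ (I I' : InfoPersp nAg) → I ≡↾ I' at 2 → ∀ a → Isub I a ⊆ Isub I' a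
  Isub-⊆ _ _ I≡I' a {b} = [ (λ ab∈I → inj₁ (to (I≡I' (a ∷ b ∷ []) (s≤s (s≤s z≤n))) ab∈I)) , inj₂ ]

  Ishift-⊆ : ∀ (I I' : InfoPersp nAg) {n} → I ≡↾ I' at suc n
           → ∀ a w → length w ≤ n → Ishift I a w → Ishift I' a w
  Ishift-⊆ _ _ I≡I' a w l (inj₁ (w∈Ag≥2 , aw∈I)) = inj₁ (w∈Ag≥2 , to (I≡I' (a ∷ w) (s≤s l)) aw∈I)
  Ishift-⊆ _ _ I≡I' a w l (inj₂ (w∈I , w=a∷w')) = inj₂ (to (I≡I' w (≤-trans l (n≤1+n _))) w∈I , w=a∷w')

  shift-∪ᴾ-≡↾ : ∀ (I I' J : InfoPersp nAg) {n} a → I ≡↾ I' at suc n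
              → (∀ w → Ishift I' a w → mem J w) → (J ∪ᴾ shiftPersp I a) ≡↾ J at n
  shift-∪ᴾ-≡↾ I I' J a I≡I' I'[a]⊆J =
    ∪ᴾ-≡↾ˡ J (shiftPersp I a) λ w l → I'[a]⊆J w ∘ Ishift-⊆ I I' I≡I' a w l

module _ {nAg : ℕ} (G : CGS nAg) where

  Consistent-antitone : ∀ χ {P Q : Pred (Fin nAg) 0ℓ} → P ⊆ Q
                      → ∀ ρ → Consistent G χ Q ρ → Consistent G χ P ρ
  Consistent-antitone χ P⊆Q (start _) _ = tt
  Consistent-antitone χ P⊆Q (ρ ▷ α) (ρ-cons , α-cons) =
    Consistent-antitone χ P⊆Q ρ ρ-cons , λ b → α-cons b ∘ P⊆Q

  ⊴-∪ᴾ-shift : ∀ {a χ χ″ ρ ρ″} (I I' J : InfoPersp nAg) → I ≡↾ I' at 3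
             → ⊴ G a ⟨ χ , I' , ρ ⟩ ⟨ χ″ , J , ρ″ ⟩
             → ⊴ G a ⟨ χ , I , ρ ⟩ ⟨ χ″ , J ∪ᴾ shiftPersp I a , ρ″ ⟩
  ⊴-∪ᴾ-shift {a} {χ} {χ″} {ρ} {ρ″} I I' J I≡I' (χ∼χ″ , I'[a]⊆J , ρ∼ρ″ , cons , cons″) =
    (λ b → χ∼χ″ b ∘ Isub-⊆ I I' I≡I'₂ a) , (λ _ → inj₂) , ρ∼ρ″ ,
    Consistent-antitone χ (Isub-⊆ I I' I≡I'₂ a) ρ cons ,
    Consistent-antitone χ″ (Isub-⊆ (J ∪ᴾ shiftPersp I a) J J∪I[a]≡J a) ρ″ cons″
    where
      I≡I'₂ : I ≡↾ I' at 2
      I≡I'₂ = ≡↾-restrict I I' (n≤1+n 2) I≡I'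

      J∪I[a]≡J : (J ∪ᴾ shiftPersp I a) ≡↾ J at 2
      J∪I[a]≡J = shift-∪ᴾ-≡↾ I I' J a I≡I' I'[a]⊆J

  Sat-≡↾ : ∀ φ χ {I I' : InfoPersp nAg} ρ → I ≡↾ I' at (kd φ + 2)
         → Sat G ⟨ χ , I , ρ ⟩ φ → Sat G ⟨ χ , I' , ρ ⟩ φ
  Sat-≡↾ (atom _) χ ρ _ holds = holds
  Sat-≡↾ ⊥f χ ρ _ holds = holds
  Sat-≡↾ (φ ⇒ ψ) χ {I} {I'} ρ I≡I' φ⇒ψ sat-φ =
    Sat-≡↾ ψ χ ρ (≡↾-restrict I I' (+-monoˡ-≤ 2 (m≤n⊔m (kd φ) (kd ψ))) I≡I')
      (φ⇒ψ (Sat-≡↾ φ χ ρ (≡↾-restrict I' I (+-monoˡ-≤ 2 (m≤m⊔n (kd φ) (kd ψ))) (≡↾-sym I I' I≡I')) sat-φ))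
  Sat-≡↾ (X φ) χ ρ I≡I' holds = Sat-≡↾ φ χ (next G χ ρ) I≡I' holds
  Sat-≡↾ (K a φ) χ {I} {I'} ρ I≡I' Kφ ⟨ χ″ , J , ρ″ ⟩ Z⊴Z″@(_ , I'[a]⊆J , _) =
    Sat-≡↾ φ χ″ ρ″ (shift-∪ᴾ-≡↾ I I' J a I≡I' I'[a]⊆J)
      (Kφ ⟨ χ″ , J ∪ᴾ shiftPersp I a , ρ″ ⟩
          (⊴-∪ᴾ-shift I I' J (≡↾-restrict I I' (s≤s (m≤n+m 2 (kd φ))) I≡I') Z⊴Z″))

lemma8 : ∀ {nAg : ℕ} (G : CGS nAg) (χ : Assignment G) (I : InfoPersp nAg)
           (ρ : Hist G) (φ : Form nAg) (I' : InfoPersp nAg)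
         → I ≡↾ I' at (kd φ + 2)
         → Sat G ⟨ χ , I , ρ ⟩ φ ⇔ Sat G ⟨ χ , I' , ρ ⟩ φ
lemma8 G χ I ρ φ I' I≡I' = mk⇔ (Sat-≡↾ G φ χ ρ I≡I') (Sat-≡↾ G φ χ ρ (≡↾-sym I I' I≡I'))
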